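{- Let $k\ge2$, $1\le t\le k$, $S=\{t,\dots,k\}$. For every instance $\Psi$ of $\mathrm{Max}\text{ - }\mathrm{B}\text{ - }\mathrm{CSP}(\mathrm{Th}^t_k)$, $\mathrm{val}_\Psi\le\gamma_{S,k}(\mathrm{bias}_\Psi)$.
   Context: $\mathrm{Th}^t_k=f_{S,k}$ where $f_{S,k}(\mathbf a)=1$ iff the Hamming weight $\|\mathbf a\|_0\in S$. An instance $\Psi$ of $\mathrm{Max}\text{ - }\mathrm{B}\text{ - }\mathrm{CSP}(f)$ on $n$ variables: constraints $(\mathbf b(\ell),\mathbf j(\ell),w(\ell))_{\ell\in[m]}$ with $\mathbf b(\ell)\in\mathbb Z_2^k$, $\mathbf j(\ell)\in[n]^k$ having distinct entries, $w(\ell)\ge0$, $W_\Psi=\sum w(\ell)>0$; $\mathrm{val}_\Psi=\max_{\mathbf x\in\mathbb Z_2^n}\frac1{W_\Psi}\sum_\ell w(\ell)f(\mathbf b(\ell)+\mathbf x|_{\mathbf j(\ell)})$ (mod-2 addition, $\mathbf x|_{\mathbf j}=(x_{j_1},\dots,x_{j_k})$). $\mathrm{bias}_\Psi(i)=\sum_{\ell,s:\,j(\ell)_s=i}(-1)^{b(\ell)_s}w(\ell)$ and $\mathrm{bias}_\Psi=\frac1{kW_\Psi}\sum_{i=1}^n|\mathrm{bias}_\Psi(i)|\in[0,1]$. For a distribution $\mathcal D$ on $\mathbb Z_2^k$, $\mathcal D\langle i\rangle$ is its mass on weight-$i$ strings; $\Delta_k$ is the set of symmetric distributions (equal-weight strings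 equiprobable); for $\mathcal D\in\Delta_k$, $\mu(\mathcal D)=\mathbb E_{\mathbf a\sim\mathcal D}[(-1)^{a_1+1}]$, $\gamma_S(\mathcal D)=\sum_{i\in S}\mathcal D\langle i\rangle$, and $\gamma_{S,k}(\mu)=\sup\{\gamma_S(\mathcal D):\mathcal D\in\Delta_k,\ \mu(\mathcal D)=\mu\}$.
   Formalization: The constraint weights $w(\ell)$ are rational rather than real, and the symmetric distributions in the supremum defining $\gamma_{S,k}$ are taken with rational probabilities. -}

module Defs where

open import Data.Bool using (Bool; true; false; if_then_else_; _xor_; _∧_; not)
open import Data.Empty using (⊥)
open import Data.Integer using (+_)
open import Data.Nat as ℕ using (ℕ; zero; suc; _≤ᵇ_)
open import Data.Fin using (Fin; _≟_)
open import Data.List using (List; map; foldr; concatMap; upTo)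
open import Data.Vec using (Vec; []; _∷_; lookup; zipWith; replicate; toList; allFin; head)
open import Data.Rational using (ℚ; 0ℚ; 1ℚ; _+_; _*_; -_; _≤_; _<_; _⊔_; ∣_∣; _÷_; _/_)
open import Data.Rational.Properties using (pos⇒nonZero)
open import Data.Rational using (positive)
open import Relation.Binary.PropositionalEquality using (_≡_)
open import Relation.Nullary.Decidable using (⌊_⌋)

-- ℤ₂ elements are Booleans (true = 1); ℤ₂^k is Vec Bool k.
Bits : ℕ → Set
Bits k = Vec Bool k

weight : ∀ {k} → Bits k → ℕ
weight [] = 0
weight (true ∷ a) = suc (weight a)
weight (false ∷ a) = weight a

allBits : (k : ℕ) → List (Bits k)
allBits zero = Data.List._∷_ [] Data.List.[]
allBits (suc k) = concatMap (λ a → Data.List._∷_ (false ∷ a) (Data.List._∷_ (true ∷ a) Data.List.[])) (allBits k)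

sumℚ : List ℚ → ℚ
sumℚ = foldr _+_ 0ℚ

WeightSet : Set
WeightSet = ℕ → Bool

fS : (S : WeightSet) (k : ℕ) → Bits k → ℚ
fS S k a = if S (weight a) then 1ℚ else 0ℚ

interval : (t k : ℕ) → WeightSet
interval t k i = (t ≤ᵇ i) ∧ (i ≤ᵇ k)

Th : (t k : ℕ) → Bits k → ℚ
Th t k = fS (interval t k) k

record Constraint (n k : ℕ) : Set where
  field
    b        : Bits k
    j        : Vec (Fin n) k
    distinct : ∀ (s s' : Fin k) → lookup j s ≡ lookup j s' → s ≡ s'
    w        : ℚ
    w≥0      : 0ℚ ≤ w

totalWeight : ∀ {n k} → List (Constraint n k) → ℚ
totalWeight cs = sumℚ (map Constraint.w cs)

record Instance (n k : ℕ) : Set where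
  field
    constraints : List (Constraint n k)
    W>0         : 0ℚ < totalWeight constraints

W : ∀ {n k} → Instance n k → ℚ
W Ψ = totalWeight (Instance.constraints Ψ)

divW : ∀ {n k} → (Ψ : Instance n k) → ℚ → ℚ
divW Ψ q = _÷_ q (W Ψ) {{pos⇒nonZero (W Ψ) {{positive (Instance.W>0 Ψ)}}}}

restrict : ∀ {n k} → Bits n → Vec (Fin n) k → Bits k
restrict x j = Data.Vec.map (lookup x) j

assignmentValue : ∀ {n k} → (Bits k → ℚ) → Instance n k → Bits n → ℚ
assignmentValue f Ψ x = divW Ψ (sumℚ (map term (Instance.constraints Ψ)))
  where
  term : _ → ℚ
  term c = Constraint.w c * f (zipWith _xor_ (Constraint.b c) (restrict x (Constraint.j c)))

val : ∀ {n k} → (Bits k → ℚ) → Instance n k → ℚ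
val {n} f Ψ = foldr _⊔_ (assignmentValue f Ψ (replicate n false))
                        (map (assignmentValue f Ψ) (allBits n))

sign : Bool → ℚ
sign false = 1ℚ
sign true  = - 1ℚ

biasVar : ∀ {n k} → Instance n k → Fin n → ℚ
biasVar {n} {k} Ψ i = sumℚ (map term (Instance.constraints Ψ))
  where
  term : Constraint n k → ℚ
  term c = sumℚ (toList (zipWith (λ bs js → if ⌊ js ≟ i ⌋ then sign bs * Constraint.w c else 0ℚ)
                                 (Constraint.b c) (Constraint.j c)))

bias : ∀ {n k} .{{_ : ℕ.NonZero k}} → Instance n k → ℚ
bias {n} {k} Ψ = ((+ 1) / k) * divW Ψ (sumℚ (toList (Data.Vec.map (λ i → ∣ biasVar Ψ i ∣) (allFin n))))

record Distribution (k : ℕ) : Set where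
  field
    prob    : Bits k → ℚ
    nonneg  : ∀ a → 0ℚ ≤ prob a
    total   : sumℚ (map prob (allBits k)) ≡ 1ℚ

massAt : ∀ {k} → Distribution k → ℕ → ℚ
massAt {k} D i = sumℚ (map (λ a → if weight a ℕ.≡ᵇ i then Distribution.prob D a else 0ℚ) (allBits k))

Symmetric : ∀ {k} → Distribution k → Set
Symmetric D = ∀ a a' → weight a ≡ weight a' → Distribution.prob D a ≡ Distribution.prob D a'

μ : ∀ {k} → Distribution (suc k) → ℚ
μ {k} D = sumℚ (map (λ a → Distribution.prob D a * sign (not (head a))) (allBits (suc k)))

γ : ∀ {k} → WeightSet → Distribution k → ℚ
γ {k} S D = sumℚ (map (λ i → if S i then massAt D i else 0ℚ) (upTo (suc k)))

γUpperBound : (S : WeightSet) (k : ℕ) → ℚ → ℚ → Set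
γUpperBound S zero m u = ⊥   -- μ is undefined for k = 0; never used (k ≥ 2)
γUpperBound S (suc k) m u = ∀ (D : Distribution (suc k)) → Symmetric D → μ D ≡ m → γ S D ≤ u

-- q ≤ γ_{S,k}(m) = sup{…}  :⇔  q ≤ every upper bound of the set
_≤γ[_,_]_ : ℚ → WeightSet → ℕ → ℚ → Set
q ≤γ[ S , k ] m = ∀ u → γUpperBound S k m u → q ≤ u

-- Fix an assignment x and write a = b(ℓ) + x|j(ℓ) for each constraint ℓ. A satisfied constraint has
-- ‖a‖₀ ≥ t, and 2‖a‖₀ = k − Σ_s (−1)^{b(ℓ)_s} (−1)^{x_{j(ℓ)_s}}. Summing with the weights and regrouping
-- the double sum by variables gives 2t·W·value(x) ≤ kW − Σ_i (−1)^{x_i} bias_Ψ(i) ≤ kW(1 + bias_Ψ), so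
-- val_Ψ ≤ min(1, k(1 + β)/2t) for β = bias_Ψ ∈ [0, 1].
--
-- Conversely, some symmetric distribution with μ = β has γ_S at least this bound. The uniform
-- distribution U_i on the strings of weight i has k·μ(U_i) = 2i − k (absorption: i·C(k, i) =
-- k·C(k − 1, i − 1)), so μ of a mixture of two levels is determined by its mean weight. If
-- k(1 + β) ≤ 2t, a mixture of U_t and U_0 with μ = β puts mass k(1 + β)/2t on weight t; otherwise a
-- mixture of U_k and U_t with μ = β puts all its mass on S.

module Submission where

open import Defs
open import Data.Nat using (ℕ; suc; _≤_; >-nonZero; s≤s; z≤n)
open import Data.Nat.Properties using (≤-trans)

open import Data.Bool using (Bool; true; false; if_then_else_; _xor_; _∧_; not; T)
open import Data.Bool.Properties using (if-float; if-swap-then)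
open import Data.Fin using (Fin; zero; suc; _≟_)
import Data.Integer as ℤ
import Data.Integer.Tactic.RingSolver as ℤ
open import Data.List using (List; []; _∷_; map; foldr; upTo; concatMap)
import Data.List.Properties as List
import Data.Nat as ℕ
import Data.Nat.Properties as ℕ
open import Data.Product using (Σ; ∃-syntax; _,_)
open import Data.Rational using (ℚ; 0ℚ; 1ℚ; _+_; _*_; -_; _-_; ∣_∣; 1/_; _/_; _⊔_; toℚᵘ)
open import Data.Rational using (NonZero; Positive; positive; nonNegative)
import Data.Rational as ℚ
import Data.Rational.Properties as ℚ
import Data.Rational.Unnormalised as ℚᵘ
import Data.Rational.Unnormalised.Properties as ℚᵘ
open import Data.Sum using (inj₁; inj₂; [_,_]′)
open import Data.Vec using (Vec; []; _∷_; lookup; zipWith; toList; allFin; replicate)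
import Data.Vec as Vec
import Data.Vec.Properties as Vec
open import Function using (id; _∘_)
open import Level using (0ℓ)
open import Relation.Binary.PropositionalEquality
  using (_≡_; refl; sym; trans; cong; cong₂; subst; module ≡-Reasoning)
open import Relation.Nullary.Decidable using (⌊_⌋; dec⇒maybe; ⌊⌋-map′; toSum)
open import Tactic.RingSolver using (solve-∀)
open import Tactic.RingSolver.Core.AlmostCommutativeRing using (AlmostCommutativeRing; fromCommutativeRing)

import Algebra.Definitions.RawMonoid ℚ.+-0-rawMonoid as Multiples

private variable
  A B : Set
  n k : ℕ

ℚ-ring : AlmostCommutativeRing 0ℓ 0ℓ
ℚ-ring = fromCommutativeRing ℚ.+-*-commutativeRing (λ x → dec⇒maybe (0ℚ ℚ.≟ x))

*-nonNeg : ∀ {p q} → 0ℚ ℚ.≤ p → 0ℚ ℚ.≤ q → 0ℚ ℚ.≤ p * q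
*-nonNeg {p} {q} 0≤p 0≤q =
  ℚ.nonNegative⁻¹ (p * q) {{ℚ.nonNeg*nonNeg⇒nonNeg p {{nonNegative 0≤p}} q {{nonNegative 0≤q}}}}

p≤q⇒0≤q-p : ∀ {p q} → p ℚ.≤ q → 0ℚ ℚ.≤ q - p
p≤q⇒0≤q-p {p} {q} p≤q = subst (ℚ._≤ q - p) (ℚ.+-inverseʳ p) (ℚ.+-monoˡ-≤ (- p) p≤q)

*-cancelˡ-≡-pos : ∀ r .{{_ : Positive r}} {p q} → r * p ≡ r * q → p ≡ q
*-cancelˡ-≡-pos r rp≡rq = ℚ.≤-antisym (ℚ.*-cancelˡ-≤-pos r (ℚ.≤-reflexive rp≡rq))
                                      (ℚ.*-cancelˡ-≤-pos r (ℚ.≤-reflexive (sym rp≡rq)))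

-p≤∣p∣ : ∀ p → - p ℚ.≤ ∣ p ∣
-p≤∣p∣ p with ℚ.∣p∣≡p∨∣p∣≡-p p
... | inj₁ ∣p∣≡p  = ℚ.≤-trans (ℚ.neg-antimono-≤ (ℚ.∣p∣≡p⇒0≤p ∣p∣≡p)) (ℚ.0≤∣p∣ p)
... | inj₂ ∣p∣≡-p = ℚ.≤-reflexive (sym ∣p∣≡-p)

∣sign*p∣≡∣p∣ : ∀ b p → ∣ sign b * p ∣ ≡ ∣ p ∣
∣sign*p∣≡∣p∣ b p =
  trans (ℚ.∣p*q∣≡∣p∣*∣q∣ (sign b) p) (trans (cong (ℚ._* ∣ p ∣) (∣sign∣ b)) (ℚ.*-identityˡ ∣ p ∣))
  where
  ∣sign∣ : ∀ b → ∣ sign b ∣ ≡ 1ℚ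
  ∣sign∣ true  = refl
  ∣sign∣ false = refl

𝟙 : Bool → ℚ
𝟙 b = if b then 1ℚ else 0ℚ

𝟙-nonNeg : ∀ b → 0ℚ ℚ.≤ 𝟙 b
𝟙-nonNeg true  = ℚ.nonNegative⁻¹ 1ℚ
𝟙-nonNeg false = ℚ.≤-refl

𝟙≤1 : ∀ b → 𝟙 b ℚ.≤ 1ℚ
𝟙≤1 true  = ℚ.≤-refl
𝟙≤1 false = ℚ.nonNegative⁻¹ 1ℚ

if-zero : ∀ b {x} → x ≡ 0ℚ → (if b then x else 0ℚ) ≡ 0ℚ
if-zero true  x≡0 = x≡0
if-zero false _   = refl

*-if : ∀ c b x → c * (if b then x else 0ℚ) ≡ (if b then c * x else 0ℚ)
*-if c true  x = refl
*-if c false x = ℚ.*-zeroʳ c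

if-linear : ∀ b p q x y →
  (if b then p * x + q * y else 0ℚ) ≡ p * (if b then x else 0ℚ) + q * (if b then y else 0ℚ)
if-linear true  p q x y = refl
if-linear false p q x y = sym (cong₂ _+_ (ℚ.*-zeroʳ p) (ℚ.*-zeroʳ q))

⟦_⟧ : ℕ → ℚ
⟦ n ⟧ = n Multiples.× 1ℚ

⟦⟧-nonNeg : ∀ n → 0ℚ ℚ.≤ ⟦ n ⟧
⟦⟧-nonNeg ℕ.zero  = ℚ.≤-refl
⟦⟧-nonNeg (suc n) = ℚ.+-mono-≤ (ℚ.nonNegative⁻¹ 1ℚ) (⟦⟧-nonNeg n)

⟦suc⟧-pos : ∀ n → 0ℚ ℚ.< ⟦ suc n ⟧
⟦suc⟧-pos n = ℚ.+-mono-<-≤ (ℚ.positive⁻¹ 1ℚ) (⟦⟧-nonNeg n)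

⟦⟧-mono : ∀ {m n} → m ≤ n → ⟦ m ⟧ ℚ.≤ ⟦ n ⟧
⟦⟧-mono {n = n} z≤n = ⟦⟧-nonNeg n
⟦⟧-mono (s≤s m≤n)   = ℚ.+-monoʳ-≤ 1ℚ (⟦⟧-mono m≤n)

toℚᵘ-⟦⟧ : ∀ n → toℚᵘ ⟦ n ⟧ ℚᵘ.≃ ℚᵘ.mkℚᵘ (ℤ.+ n) 0
toℚᵘ-⟦⟧ ℕ.zero  = ℚᵘ.≃-refl
toℚᵘ-⟦⟧ (suc n) = begin
  toℚᵘ (1ℚ + ⟦ n ⟧)                ≈⟨ ℚ.toℚᵘ-homo-+ 1ℚ ⟦ n ⟧ ⟩
  toℚᵘ 1ℚ ℚᵘ.+ toℚᵘ ⟦ n ⟧          ≈⟨ ℚᵘ.+-congʳ (toℚᵘ 1ℚ) (toℚᵘ-⟦⟧ n) ⟩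
  toℚᵘ 1ℚ ℚᵘ.+ ℚᵘ.mkℚᵘ (ℤ.+ n) 0   ≈⟨ ℚᵘ.*≡* (cross-multiplied (ℤ.+ n)) ⟩
  ℚᵘ.mkℚᵘ (ℤ.+ suc n) 0            ∎
  where
  open ℚᵘ.≃-Reasoning
  cross-multiplied : ∀ a → (ℤ.+ 1 ℤ.* ℤ.+ 1 ℤ.+ a ℤ.* ℤ.+ 1) ℤ.* ℤ.+ 1 ≡ (ℤ.+ 1 ℤ.+ a) ℤ.* (ℤ.+ 1 ℤ.* ℤ.+ 1)
  cross-multiplied = ℤ.solve-∀

1/k*⟦k⟧ : ∀ k → (ℤ.+ 1 / suc k) * ⟦ suc k ⟧ ≡ 1ℚ
1/k*⟦k⟧ k = ℚ.toℚᵘ-injective (begin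
  toℚᵘ ((ℤ.+ 1 / suc k) * ⟦ suc k ⟧)
    ≈⟨ ℚ.toℚᵘ-homo-* (ℤ.+ 1 / suc k) ⟦ suc k ⟧ ⟩
  toℚᵘ (ℤ.+ 1 / suc k) ℚᵘ.* toℚᵘ ⟦ suc k ⟧
    ≈⟨ ℚᵘ.*-cong (ℚ.toℚᵘ-fromℚᵘ (ℚᵘ.mkℚᵘ (ℤ.+ 1) k)) (toℚᵘ-⟦⟧ (suc k)) ⟩
  ℚᵘ.1/ K ℚᵘ.* K
    ≈⟨ ℚᵘ.*-inverseˡ K ⟩
  ℚᵘ.1ℚᵘ
    ∎)
  where
  open ℚᵘ.≃-Reasoning
  K = ℚᵘ.mkℚᵘ (ℤ.+ suc k) 0

∑ : List A → (A → ℚ) → ℚ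
∑ xs f = sumℚ (map f xs)

infixr 5 ∑
syntax ∑ xs (λ x → f) = ∑[ x ∈ xs ] f

∑-cong : ∀ (xs : List A) {f g : A → ℚ} → (∀ x → f x ≡ g x) → ∑ xs f ≡ ∑ xs g
∑-cong []       f≗g = refl
∑-cong (x ∷ xs) f≗g = cong₂ _+_ (f≗g x) (∑-cong xs f≗g)

∑-zero : ∀ (xs : List A) → ∑[ x ∈ xs ] 0ℚ ≡ 0ℚ
∑-zero []       = refl
∑-zero (x ∷ xs) = cong (0ℚ +_) (∑-zero xs)

∑-+ : ∀ (xs : List A) (f g : A → ℚ) → ∑[ x ∈ xs ] (f x + g x) ≡ ∑ xs f + ∑ xs g
∑-+ []       f g = refl
∑-+ (x ∷ xs) f g =
  trans (cong (f x + g x +_) (∑-+ xs f g)) (interchange (f x) (g x) (∑ xs f) (∑ xs g))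
  where
  interchange : ∀ a b c d → (a + b) + (c + d) ≡ (a + c) + (b + d)
  interchange = solve-∀ ℚ-ring

∑-*ˡ : ∀ (xs : List A) c (f : A → ℚ) → ∑[ x ∈ xs ] (c * f x) ≡ c * ∑ xs f
∑-*ˡ []       c f = sym (ℚ.*-zeroʳ c)
∑-*ˡ (x ∷ xs) c f =
  trans (cong (c * f x +_) (∑-*ˡ xs c f)) (sym (ℚ.*-distribˡ-+ c (f x) (∑ xs f)))

∑-linear : ∀ (xs : List A) p q (f g : A → ℚ) →
           ∑[ x ∈ xs ] (p * f x + q * g x) ≡ p * ∑ xs f + q * ∑ xs g
∑-linear xs p q f g = trans (∑-+ xs _ _) (cong₂ _+_ (∑-*ˡ xs p f) (∑-*ˡ xs q g))

∑-neg : ∀ (xs : List A) (f : A → ℚ) → ∑[ x ∈ xs ] (- f x) ≡ - ∑ xs f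
∑-neg []       f = refl
∑-neg (x ∷ xs) f = trans (cong (- f x +_) (∑-neg xs f)) (sym (ℚ.neg-distrib-+ (f x) (∑ xs f)))

∑-swap : ∀ (xs : List A) (ys : List B) (f : A → B → ℚ) →
         ∑[ x ∈ xs ] ∑[ y ∈ ys ] f x y ≡ ∑[ y ∈ ys ] ∑[ x ∈ xs ] f x y
∑-swap []       ys f = sym (∑-zero ys)
∑-swap (x ∷ xs) ys f =
  trans (cong (∑ ys (f x) +_) (∑-swap xs ys f)) (sym (∑-+ ys (f x) (λ y → ∑[ x ∈ xs ] f x y)))

∑-if : ∀ (xs : List A) b (f : A → ℚ) →
       ∑[ x ∈ xs ] (if b then f x else 0ℚ) ≡ (if b then ∑ xs f else 0ℚ)
∑-if xs true  f = refl
∑-if xs false f = ∑-zero xs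

∑-map : ∀ (g : A → B) (xs : List A) (f : B → ℚ) → ∑ (map g xs) f ≡ ∑[ x ∈ xs ] f (g x)
∑-map g xs f = cong sumℚ (sym (List.map-∘ xs))

∑-mono : ∀ (xs : List A) {f g : A → ℚ} → (∀ x → f x ℚ.≤ g x) → ∑ xs f ℚ.≤ ∑ xs g
∑-mono []       f≤g = ℚ.≤-refl
∑-mono (x ∷ xs) f≤g = ℚ.+-mono-≤ (f≤g x) (∑-mono xs f≤g)

∑-nonNeg : ∀ (xs : List A) {f : A → ℚ} → (∀ x → 0ℚ ℚ.≤ f x) → 0ℚ ℚ.≤ ∑ xs f
∑-nonNeg xs {f} 0≤f = subst (ℚ._≤ ∑ xs f) (∑-zero xs) (∑-mono xs 0≤f)

∣∑∣≤∑∣∣ : ∀ (xs : List A) (f : A → ℚ) → ∣ ∑ xs f ∣ ℚ.≤ ∑[ x ∈ xs ] ∣ f x ∣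
∣∑∣≤∑∣∣ []       f = ℚ.≤-refl
∣∑∣≤∑∣∣ (x ∷ xs) f =
  ℚ.≤-trans (ℚ.∣p+q∣≤∣p∣+∣q∣ (f x) (∑ xs f)) (ℚ.+-monoʳ-≤ ∣ f x ∣ (∣∑∣≤∑∣∣ xs f))

∑-allBits-suc : ∀ k (f : Bits (suc k) → ℚ) →
                ∑ (allBits (suc k)) f ≡ ∑[ a ∈ allBits k ] (f (false ∷ a) + f (true ∷ a))
∑-allBits-suc k f = pairs (allBits k)
  where
  pairs : ∀ as → ∑ (concatMap (λ a → (false ∷ a) ∷ (true ∷ a) ∷ []) as) f
                 ≡ ∑[ a ∈ as ] (f (false ∷ a) + f (true ∷ a))
  pairs []       = refl
  pairs (a ∷ as) = trans (cong (λ s → f (false ∷ a) + (f (true ∷ a) + s)) (pairs as))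
                         (sym (ℚ.+-assoc (f (false ∷ a)) (f (true ∷ a)) _))

variables : (n : ℕ) → List (Fin n)
variables n = toList (allFin n)

∑-variables-suc : ∀ n (f : Fin (suc n) → ℚ) →
                  ∑ (variables (suc n)) f ≡ f zero + (∑[ i ∈ variables n ] f (suc i))
∑-variables-suc n f = begin
  ∑ (toList (allFin (suc n))) f
    ≡⟨ cong (λ is → ∑ (toList is) f) (Vec.allFin-map n) ⟩
  f zero + ∑ (toList (Vec.map suc (allFin n))) f
    ≡⟨ cong (λ is → f zero + ∑ is f) (Vec.toList-map suc (allFin n)) ⟩
  f zero + ∑ (map suc (variables n)) f
    ≡⟨ cong (f zero +_) (∑-map suc (variables n) f) ⟩
  f zero + (∑[ i ∈ variables n ] f (suc i))
    ∎
  where open ≡-Reasoning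

∑-variables-δ : ∀ {n} (j : Fin n) (g : Fin n → ℚ) →
                ∑[ i ∈ variables n ] (if ⌊ j ≟ i ⌋ then g i else 0ℚ) ≡ g j
∑-variables-δ {suc n} zero g = begin
  ∑ (variables (suc n)) δ              ≡⟨ ∑-variables-suc n δ ⟩
  g zero + (∑[ i ∈ variables n ] 0ℚ)   ≡⟨ cong (g zero +_) (∑-zero (variables n)) ⟩
  g zero + 0ℚ                          ≡⟨ ℚ.+-identityʳ (g zero) ⟩
  g zero                               ∎
  where
  open ≡-Reasoning
  δ : Fin (suc n) → ℚ
  δ i = if ⌊ zero ≟ i ⌋ then g i else 0ℚ
∑-variables-δ {suc n} (suc j) g = begin
  ∑ (variables (suc n)) δ                                                   ≡⟨ ∑-variables-suc n δ ⟩
  0ℚ + (∑[ i ∈ variables n ] δ (suc i))                                     ≡⟨ ℚ.+-identityˡ _ ⟩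
  ∑[ i ∈ variables n ] δ (suc i)                                            ≡⟨ ∑-cong (variables n) suc≟suc ⟩
  ∑[ i ∈ variables n ] (if ⌊ j ≟ i ⌋ then g (suc i) else 0ℚ)                ≡⟨ ∑-variables-δ j (g ∘ suc) ⟩
  g (suc j)                                                                 ∎
  where
  open ≡-Reasoning
  δ : Fin (suc n) → ℚ
  δ i = if ⌊ suc j ≟ i ⌋ then g i else 0ℚ
  suc≟suc : ∀ i → δ (suc i) ≡ (if ⌊ j ≟ i ⌋ then g (suc i) else 0ℚ)
  suc≟suc i = cong (if_then g (suc i) else 0ℚ) (⌊⌋-map′ _ _ (j ≟ i))

∑-upTo-suc : ∀ n (f : ℕ → ℚ) → ∑ (upTo (suc n)) f ≡ f 0 + (∑[ m ∈ upTo n ] f (suc m))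
∑-upTo-suc n f = begin
  ∑ (upTo (suc n)) f                 ≡⟨ cong (λ ms → f 0 + ∑ ms f) (sym (List.map-applyUpTo id suc n)) ⟩
  f 0 + ∑ (map suc (upTo n)) f       ≡⟨ cong (f 0 +_) (∑-map suc (upTo n) f) ⟩
  f 0 + (∑[ m ∈ upTo n ] f (suc m))  ∎
  where open ≡-Reasoning

∑-upTo-δ : ∀ {i n} → i ℕ.< n → (g : ℕ → ℚ) → ∑[ m ∈ upTo n ] (if i ℕ.≡ᵇ m then g m else 0ℚ) ≡ g i
∑-upTo-δ {ℕ.zero} {suc n} _ g = begin
  ∑ (upTo (suc n)) δ           ≡⟨ ∑-upTo-suc n δ ⟩
  g 0 + (∑[ m ∈ upTo n ] 0ℚ)   ≡⟨ cong (g 0 +_) (∑-zero (upTo n)) ⟩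
  g 0 + 0ℚ                     ≡⟨ ℚ.+-identityʳ (g 0) ⟩
  g 0                          ∎
  where
  open ≡-Reasoning
  δ : ℕ → ℚ
  δ m = if 0 ℕ.≡ᵇ m then g m else 0ℚ
∑-upTo-δ {suc i} {suc n} (s≤s i<n) g = begin
  ∑ (upTo (suc n)) δ                                           ≡⟨ ∑-upTo-suc n δ ⟩
  0ℚ + (∑[ m ∈ upTo n ] δ (suc m))                             ≡⟨ ℚ.+-identityˡ _ ⟩
  ∑[ m ∈ upTo n ] (if i ℕ.≡ᵇ m then g (suc m) else 0ℚ)         ≡⟨ ∑-upTo-δ i<n (g ∘ suc) ⟩
  g (suc i)                                                    ∎
  where
  open ≡-Reasoning
  δ : ℕ → ℚ
  δ m = if suc i ℕ.≡ᵇ m then g m else 0ℚ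

-- Bit strings and the threshold predicate

⟦weight-∷⟧ : ∀ b (a : Bits k) → ⟦ weight (b ∷ a) ⟧ ≡ 𝟙 b + ⟦ weight a ⟧
⟦weight-∷⟧ true  a = refl
⟦weight-∷⟧ false a = sym (ℚ.+-identityˡ _)

correlation : Bits k → Bits k → ℚ
correlation b y = sumℚ (toList (zipWith (λ p q → sign p * sign q) b y))

twice-𝟙-xor : ∀ p q → ⟦ 2 ⟧ * 𝟙 (p xor q) ≡ 1ℚ - sign p * sign q
twice-𝟙-xor false false = refl
twice-𝟙-xor false true  = refl
twice-𝟙-xor true  false = refl
twice-𝟙-xor true  true  = refl

twice-weight-xor : ∀ (b y : Bits k) → ⟦ 2 ⟧ * ⟦ weight (zipWith _xor_ b y) ⟧ ≡ ⟦ k ⟧ - correlation b y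
twice-weight-xor []      []      = refl
twice-weight-xor {suc k} (p ∷ b) (q ∷ y) = begin
  ⟦ 2 ⟧ * ⟦ weight ((p xor q) ∷ b⊕y) ⟧
    ≡⟨ cong (⟦ 2 ⟧ *_) (⟦weight-∷⟧ (p xor q) b⊕y) ⟩
  ⟦ 2 ⟧ * (𝟙 (p xor q) + ⟦ weight b⊕y ⟧)
    ≡⟨ ℚ.*-distribˡ-+ ⟦ 2 ⟧ (𝟙 (p xor q)) ⟦ weight b⊕y ⟧ ⟩
  ⟦ 2 ⟧ * 𝟙 (p xor q) + ⟦ 2 ⟧ * ⟦ weight b⊕y ⟧
    ≡⟨ cong₂ _+_ (twice-𝟙-xor p q) (twice-weight-xor b y) ⟩
  (1ℚ - sign p * sign q) + (⟦ k ⟧ - correlation b y)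
    ≡⟨ interchange 1ℚ (sign p * sign q) ⟦ k ⟧ (correlation b y) ⟩
  (1ℚ + ⟦ k ⟧) - (sign p * sign q + correlation b y)
    ∎
  where
  open ≡-Reasoning
  b⊕y = zipWith _xor_ b y
  interchange : ∀ a b c d → (a - b) + (c - d) ≡ (a + c) - (b + d)
  interchange = solve-∀ ℚ-ring

interval-member : ∀ {t k m} → t ≤ m → m ≤ k → interval t k m ≡ true
interval-member t≤m m≤k = cong₂ _∧_ (T⇒≡true (ℕ.≤⇒≤ᵇ t≤m)) (T⇒≡true (ℕ.≤⇒≤ᵇ m≤k))
  where
  T⇒≡true : ∀ {b} → T b → b ≡ true
  T⇒≡true {true} _ = refl

threshold-≤-weight : ∀ t k m → ⟦ t ⟧ * 𝟙 (interval t k m) ℚ.≤ ⟦ m ⟧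
threshold-≤-weight t k m with t ℕ.≤ᵇ m in t≤ᵇm
... | false = begin
  ⟦ t ⟧ * 0ℚ   ≡⟨ ℚ.*-zeroʳ ⟦ t ⟧ ⟩
  0ℚ           ≤⟨ ⟦⟧-nonNeg m ⟩
  ⟦ m ⟧        ∎
  where open ℚ.≤-Reasoning
... | true = begin
  ⟦ t ⟧ * 𝟙 (m ℕ.≤ᵇ k)  ≤⟨ ℚ.*-monoˡ-≤-nonNeg ⟦ t ⟧ {{nonNegative (⟦⟧-nonNeg t)}} (𝟙≤1 (m ℕ.≤ᵇ k)) ⟩
  ⟦ t ⟧ * 1ℚ            ≡⟨ ℚ.*-identityʳ ⟦ t ⟧ ⟩
  ⟦ t ⟧                 ≤⟨ ⟦⟧-mono (ℕ.≤ᵇ⇒≤ t m (subst T (sym t≤ᵇm) _)) ⟩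
  ⟦ m ⟧                 ∎
  where open ℚ.≤-Reasoning

-- Occurrences of variables and the bias

-- With c p = (−1)^p w(ℓ), the sum of these over the constraints ℓ is definitionally biasVar Ψ i.
occurrences : (Bool → ℚ) → Bits k → Vec (Fin n) k → Fin n → ℚ
occurrences c b j i = sumℚ (toList (zipWith (λ p v → if ⌊ v ≟ i ⌋ then c p else 0ℚ) b j))

∑-sign*occurrences : ∀ (x : Bits n) w (b : Bits k) (j : Vec (Fin n) k) →
  ∑[ i ∈ variables n ] sign (lookup x i) * occurrences (λ p → sign p * w) b j i
    ≡ w * correlation b (restrict x j)
∑-sign*occurrences {n} x w [] [] = begin
  ∑[ i ∈ variables n ] sign (lookup x i) * 0ℚ  ≡⟨ ∑-cong (variables n) (λ i → ℚ.*-zeroʳ (sign (lookup x i))) ⟩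
  ∑[ i ∈ variables n ] 0ℚ                      ≡⟨ ∑-zero (variables n) ⟩
  0ℚ                                           ≡⟨ ℚ.*-zeroʳ w ⟨
  w * 0ℚ                                       ∎
  where open ≡-Reasoning
∑-sign*occurrences {n} x w (p ∷ b) (v ∷ j) = begin
  ∑[ i ∈ variables n ] s i * (δ i + rest i)
    ≡⟨ ∑-cong (variables n) (λ i → ℚ.*-distribˡ-+ (s i) (δ i) (rest i)) ⟩
  ∑[ i ∈ variables n ] (s i * δ i + s i * rest i)
    ≡⟨ ∑-+ (variables n) (λ i → s i * δ i) (λ i → s i * rest i) ⟩
  (∑[ i ∈ variables n ] s i * δ i) + (∑[ i ∈ variables n ] s i * rest i)
    ≡⟨ cong₂ _+_ at-v (∑-sign*occurrences x w b j) ⟩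
  s v * (sign p * w) + w * correlation b (restrict x j)
    ≡⟨ regroup (s v) (sign p) w (correlation b (restrict x j)) ⟩
  w * (sign p * s v + correlation b (restrict x j))
    ∎
  where
  open ≡-Reasoning
  s δ rest : Fin n → ℚ
  s i = sign (lookup x i)
  δ i = if ⌊ v ≟ i ⌋ then sign p * w else 0ℚ
  rest = occurrences (λ p → sign p * w) b j
  at-v : ∑[ i ∈ variables n ] s i * δ i ≡ s v * (sign p * w)
  at-v = trans (∑-cong (variables n) (λ i → *-if (s i) ⌊ v ≟ i ⌋ (sign p * w)))
               (∑-variables-δ v (λ i → s i * (sign p * w)))
  regroup : ∀ a b c d → a * (b * c) + c * d ≡ c * (b * a + d)
  regroup = solve-∀ ℚ-ring

∑-occurrences : ∀ w (b : Bits k) (j : Vec (Fin n) k) →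
                ∑[ i ∈ variables n ] occurrences (λ _ → w) b j i ≡ ⟦ k ⟧ * w
∑-occurrences {n = n} w [] [] = trans (∑-zero (variables n)) (sym (ℚ.*-zeroˡ w))
∑-occurrences {suc k} {n} w (p ∷ b) (v ∷ j) = begin
  ∑[ i ∈ variables n ] (δ i + rest i)
    ≡⟨ ∑-+ (variables n) δ rest ⟩
  (∑[ i ∈ variables n ] δ i) + (∑[ i ∈ variables n ] rest i)
    ≡⟨ cong₂ _+_ (∑-variables-δ v (λ _ → w)) (∑-occurrences w b j) ⟩
  w + ⟦ k ⟧ * w
    ≡⟨ suc-* w ⟦ k ⟧ ⟩
  (1ℚ + ⟦ k ⟧) * w
    ∎
  where
  open ≡-Reasoning
  δ rest : Fin n → ℚ
  δ i = if ⌊ v ≟ i ⌋ then w else 0ℚ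
  rest = occurrences (λ _ → w) b j
  suc-* : ∀ w K → w + K * w ≡ (1ℚ + K) * w
  suc-* = solve-∀ ℚ-ring

∣occurrences∣≤ : ∀ {w} → 0ℚ ℚ.≤ w → ∀ (b : Bits k) (j : Vec (Fin n) k) i →
                 ∣ occurrences (λ p → sign p * w) b j i ∣ ℚ.≤ occurrences (λ _ → w) b j i
∣occurrences∣≤ 0≤w []      []      i = ℚ.≤-refl
∣occurrences∣≤ {w = w} 0≤w (p ∷ b) (v ∷ j) i = begin
  ∣ δ + occurrences (λ p → sign p * w) b j i ∣
    ≤⟨ ℚ.∣p+q∣≤∣p∣+∣q∣ δ (occurrences (λ p → sign p * w) b j i) ⟩
  ∣ δ ∣ + ∣ occurrences (λ p → sign p * w) b j i ∣
    ≤⟨ ℚ.+-mono-≤ (ℚ.≤-reflexive ∣δ∣) (∣occurrences∣≤ 0≤w b j i) ⟩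
  (if ⌊ v ≟ i ⌋ then w else 0ℚ) + occurrences (λ _ → w) b j i
    ∎
  where
  open ℚ.≤-Reasoning
  δ : ℚ
  δ = if ⌊ v ≟ i ⌋ then sign p * w else 0ℚ
  ∣δ∣ : ∣ δ ∣ ≡ (if ⌊ v ≟ i ⌋ then w else 0ℚ)
  ∣δ∣ = trans (if-float ∣_∣ ⌊ v ≟ i ⌋)
              (cong (if ⌊ v ≟ i ⌋ then_else 0ℚ) (trans (∣sign*p∣≡∣p∣ p w) (ℚ.0≤p⇒∣p∣≡p 0≤w)))

satisfiedWeight : (Bits k → ℚ) → Instance n k → Bits n → ℚ
satisfiedWeight f Ψ x = ∑[ c ∈ constraints ] w c * f (zipWith _xor_ (b c) (restrict x (j c)))
  where
  open Instance Ψ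
  open Constraint

biasMass : Instance n k → ℚ
biasMass {n} Ψ = ∑[ i ∈ variables n ] ∣ biasVar Ψ i ∣

biasMass≤kW : ∀ (Ψ : Instance n k) → biasMass Ψ ℚ.≤ ⟦ k ⟧ * W Ψ
biasMass≤kW {n} {k} Ψ = begin
  ∑[ i ∈ variables n ] ∣ biasVar Ψ i ∣
    ≤⟨ ∑-mono (variables n) (λ i → ∣∑∣≤∑∣∣ cs (λ c → signed c i)) ⟩
  ∑[ i ∈ variables n ] ∑[ c ∈ cs ] ∣ signed c i ∣
    ≤⟨ ∑-mono (variables n) (λ i → ∑-mono cs (λ c → ∣occurrences∣≤ (w≥0 c) (b c) (j c) i)) ⟩
  ∑[ i ∈ variables n ] ∑[ c ∈ cs ] unsigned c i
    ≡⟨ ∑-swap (variables n) cs (λ i c → unsigned c i) ⟩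
  ∑[ c ∈ cs ] ∑[ i ∈ variables n ] unsigned c i
    ≡⟨ ∑-cong cs (λ c → ∑-occurrences (w c) (b c) (j c)) ⟩
  ∑[ c ∈ cs ] ⟦ k ⟧ * w c
    ≡⟨ ∑-*ˡ cs ⟦ k ⟧ w ⟩
  ⟦ k ⟧ * W Ψ
    ∎
  where
  open ℚ.≤-Reasoning
  open Constraint
  cs = Instance.constraints Ψ
  signed unsigned : Constraint n k → Fin n → ℚ
  signed c   = occurrences (λ p → sign p * w c) (b c) (j c)
  unsigned c = occurrences (λ _ → w c) (b c) (j c)

∑-sign*biasVar : ∀ (Ψ : Instance n k) (x : Bits n) →
  ∑[ i ∈ variables n ] sign (lookup x i) * biasVar Ψ i
    ≡ ∑[ c ∈ Instance.constraints Ψ ]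
        Constraint.w c * correlation (Constraint.b c) (restrict x (Constraint.j c))
∑-sign*biasVar {n} {k} Ψ x = begin
  ∑[ i ∈ variables n ] s i * (∑[ c ∈ cs ] signed c i)
    ≡⟨ ∑-cong (variables n) (λ i → sym (∑-*ˡ cs (s i) (λ c → signed c i))) ⟩
  ∑[ i ∈ variables n ] ∑[ c ∈ cs ] s i * signed c i
    ≡⟨ ∑-swap (variables n) cs (λ i c → s i * signed c i) ⟩
  ∑[ c ∈ cs ] ∑[ i ∈ variables n ] s i * signed c i
    ≡⟨ ∑-cong cs (λ c → ∑-sign*occurrences x (w c) (b c) (j c)) ⟩
  ∑[ c ∈ cs ] w c * correlation (b c) (restrict x (j c))
    ∎
  where
  open ≡-Reasoning
  open Constraint
  cs = Instance.constraints Ψ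
  s : Fin n → ℚ
  s i = sign (lookup x i)
  signed : Constraint n k → Fin n → ℚ
  signed c = occurrences (λ p → sign p * w c) (b c) (j c)

threshold-term : ∀ t {w} → 0ℚ ℚ.≤ w → (b y : Bits k) →
  ⟦ 2 ⟧ * ⟦ t ⟧ * (w * Th t k (zipWith _xor_ b y)) ℚ.≤ ⟦ k ⟧ * w + - (w * correlation b y)
threshold-term {k} t {w} 0≤w b y = begin
  ⟦ 2 ⟧ * ⟦ t ⟧ * (w * Th t k a)       ≡⟨ reassoc ⟦ 2 ⟧ ⟦ t ⟧ w (Th t k a) ⟩
  w * (⟦ 2 ⟧ * (⟦ t ⟧ * Th t k a))     ≤⟨ ℚ.*-monoˡ-≤-nonNeg w {{nonNegative 0≤w}}
                                           (ℚ.*-monoˡ-≤-nonNeg ⟦ 2 ⟧ (threshold-≤-weight t k (weight a))) ⟩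
  w * (⟦ 2 ⟧ * ⟦ weight a ⟧)           ≡⟨ cong (w *_) (twice-weight-xor b y) ⟩
  w * (⟦ k ⟧ - correlation b y)        ≡⟨ expand w ⟦ k ⟧ (correlation b y) ⟩
  ⟦ k ⟧ * w + - (w * correlation b y)  ∎
  where
  open ℚ.≤-Reasoning
  a = zipWith _xor_ b y
  reassoc : ∀ d t w h → d * t * (w * h) ≡ w * (d * (t * h))
  reassoc = solve-∀ ℚ-ring
  expand : ∀ w K C → w * (K - C) ≡ K * w + - (w * C)
  expand = solve-∀ ℚ-ring

threshold-satisfiedWeight : ∀ t (Ψ : Instance n k) (x : Bits n) →
  ⟦ 2 ⟧ * ⟦ t ⟧ * satisfiedWeight (Th t k) Ψ x ℚ.≤ ⟦ k ⟧ * W Ψ + biasMass Ψ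
threshold-satisfiedWeight {n} {k} t Ψ x = begin
  ⟦ 2 ⟧ * ⟦ t ⟧ * (∑[ c ∈ cs ] w c * Th t k (a c))
    ≡⟨ ∑-*ˡ cs (⟦ 2 ⟧ * ⟦ t ⟧) (λ c → w c * Th t k (a c)) ⟨
  ∑[ c ∈ cs ] ⟦ 2 ⟧ * ⟦ t ⟧ * (w c * Th t k (a c))
    ≤⟨ ∑-mono cs (λ c → threshold-term t (w≥0 c) (b c) (y c)) ⟩
  ∑[ c ∈ cs ] (⟦ k ⟧ * w c + - corr c)
    ≡⟨ ∑-+ cs (λ c → ⟦ k ⟧ * w c) (λ c → - corr c) ⟩
  (∑[ c ∈ cs ] ⟦ k ⟧ * w c) + (∑[ c ∈ cs ] - corr c)
    ≡⟨ cong₂ _+_ (∑-*ˡ cs ⟦ k ⟧ w) (∑-neg cs corr) ⟩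
  ⟦ k ⟧ * W Ψ + - (∑[ c ∈ cs ] corr c)
    ≡⟨ cong (λ z → ⟦ k ⟧ * W Ψ + - z) (∑-sign*biasVar Ψ x) ⟨
  ⟦ k ⟧ * W Ψ + - (∑[ i ∈ variables n ] sign (lookup x i) * biasVar Ψ i)
    ≡⟨ cong (⟦ k ⟧ * W Ψ +_) (∑-neg (variables n) (λ i → sign (lookup x i) * biasVar Ψ i)) ⟨
  ⟦ k ⟧ * W Ψ + (∑[ i ∈ variables n ] - (sign (lookup x i) * biasVar Ψ i))
    ≤⟨ ℚ.+-monoʳ-≤ (⟦ k ⟧ * W Ψ) (∑-mono (variables n) -sign*bias≤∣bias∣) ⟩
  ⟦ k ⟧ * W Ψ + biasMass Ψ
    ∎
  where
  open ℚ.≤-Reasoning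
  open Constraint
  cs = Instance.constraints Ψ
  y a : Constraint n k → Bits k
  y c = restrict x (j c)
  a c = zipWith _xor_ (b c) (y c)
  corr : Constraint n k → ℚ
  corr c = w c * correlation (b c) (y c)
  -sign*bias≤∣bias∣ : ∀ i → - (sign (lookup x i) * biasVar Ψ i) ℚ.≤ ∣ biasVar Ψ i ∣
  -sign*bias≤∣bias∣ i = subst (- (sign (lookup x i) * biasVar Ψ i) ℚ.≤_)
                              (∣sign*p∣≡∣p∣ (lookup x i) (biasVar Ψ i))
                              (-p≤∣p∣ (sign (lookup x i) * biasVar Ψ i))

module _ (Ψ : Instance n k) where

  private instance
    W-positive : Positive (W Ψ)
    W-positive = positive (Instance.W>0 Ψ)
    W-nonZero : NonZero (W Ψ)
    W-nonZero = ℚ.pos⇒nonZero (W Ψ)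
    1/W-nonNegative : ℚ.NonNegative (1/ W Ψ)
    1/W-nonNegative = ℚ.pos⇒nonNeg (1/ W Ψ) {{ℚ.1/pos⇒pos (W Ψ)}}

  divW-mono : ∀ {p q} → p ℚ.≤ q → divW Ψ p ℚ.≤ divW Ψ q
  divW-mono = ℚ.*-monoʳ-≤-nonNeg (1/ W Ψ)

  divW-nonNeg : ∀ {p} → 0ℚ ℚ.≤ p → 0ℚ ℚ.≤ divW Ψ p
  divW-nonNeg 0≤p = ℚ.≤-trans (ℚ.≤-reflexive (sym (ℚ.*-zeroˡ (1/ W Ψ)))) (divW-mono 0≤p)

  divW-*W : ∀ p → divW Ψ (p * W Ψ) ≡ p
  divW-*W p = begin
    p * W Ψ * 1/ W Ψ     ≡⟨ ℚ.*-assoc p (W Ψ) (1/ W Ψ) ⟩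
    p * (W Ψ * 1/ W Ψ)   ≡⟨ cong (p *_) (ℚ.*-inverseʳ (W Ψ)) ⟩
    p * 1ℚ               ≡⟨ ℚ.*-identityʳ p ⟩
    p                    ∎
    where open ≡-Reasoning

  satisfiedWeight≤W : ∀ {f} → (∀ a → f a ℚ.≤ 1ℚ) → ∀ x → satisfiedWeight f Ψ x ℚ.≤ W Ψ
  satisfiedWeight≤W {f} f≤1 x = ∑-mono (Instance.constraints Ψ) w*f≤w
    where
    open Constraint
    w*f≤w : ∀ c → w c * f (zipWith _xor_ (b c) (restrict x (j c))) ℚ.≤ w c
    w*f≤w c = ℚ.≤-trans (ℚ.*-monoˡ-≤-nonNeg (w c) {{nonNegative (w≥0 c)}} (f≤1 _))
                        (ℚ.≤-reflexive (ℚ.*-identityʳ (w c)))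

  assignmentValue≤1 : ∀ {f} → (∀ a → f a ℚ.≤ 1ℚ) → ∀ x → assignmentValue f Ψ x ℚ.≤ 1ℚ
  assignmentValue≤1 f≤1 x =
    ℚ.≤-trans (divW-mono (satisfiedWeight≤W f≤1 x)) (ℚ.≤-reflexive (ℚ.*-inverseʳ (W Ψ)))

  threshold-assignmentValue : ∀ t x →
    ⟦ 2 ⟧ * ⟦ t ⟧ * assignmentValue (Th t k) Ψ x ℚ.≤ ⟦ k ⟧ + divW Ψ (biasMass Ψ)
  threshold-assignmentValue t x = begin
    ⟦ 2 ⟧ * ⟦ t ⟧ * divW Ψ (satisfiedWeight (Th t k) Ψ x)
      ≡⟨ ℚ.*-assoc (⟦ 2 ⟧ * ⟦ t ⟧) (satisfiedWeight (Th t k) Ψ x) (1/ W Ψ) ⟨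
    divW Ψ (⟦ 2 ⟧ * ⟦ t ⟧ * satisfiedWeight (Th t k) Ψ x)
      ≤⟨ divW-mono (threshold-satisfiedWeight t Ψ x) ⟩
    divW Ψ (⟦ k ⟧ * W Ψ + biasMass Ψ)
      ≡⟨ ℚ.*-distribʳ-+ (1/ W Ψ) (⟦ k ⟧ * W Ψ) (biasMass Ψ) ⟩
    divW Ψ (⟦ k ⟧ * W Ψ) + divW Ψ (biasMass Ψ)
      ≡⟨ cong (_+ divW Ψ (biasMass Ψ)) (divW-*W ⟦ k ⟧) ⟩
    ⟦ k ⟧ + divW Ψ (biasMass Ψ)
      ∎
    where open ℚ.≤-Reasoning

⟦k⟧*bias : ∀ (Ψ : Instance n (suc k)) → ⟦ suc k ⟧ * bias Ψ ≡ divW Ψ (biasMass Ψ)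
⟦k⟧*bias {n} {k} Ψ = begin
  ⟦ suc k ⟧ * ((ℤ.+ 1 / suc k) * divW Ψ mass)
    ≡⟨ ℚ.*-assoc ⟦ suc k ⟧ (ℤ.+ 1 / suc k) (divW Ψ mass) ⟨
  ⟦ suc k ⟧ * (ℤ.+ 1 / suc k) * divW Ψ mass
    ≡⟨ cong (_* divW Ψ mass) (trans (ℚ.*-comm ⟦ suc k ⟧ (ℤ.+ 1 / suc k)) (1/k*⟦k⟧ k)) ⟩
  1ℚ * divW Ψ mass
    ≡⟨ ℚ.*-identityˡ (divW Ψ mass) ⟩
  divW Ψ mass
    ≡⟨ cong (divW Ψ ∘ sumℚ) (Vec.toList-map (λ i → ∣ biasVar Ψ i ∣) (allFin n)) ⟩
  divW Ψ (biasMass Ψ)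
    ∎
  where
  open ≡-Reasoning
  mass = sumℚ (toList (Vec.map (λ i → ∣ biasVar Ψ i ∣) (allFin n)))

bias-nonNeg : ∀ (Ψ : Instance n (suc k)) → 0ℚ ℚ.≤ bias Ψ
bias-nonNeg {n} {k} Ψ = ℚ.*-cancelˡ-≤-pos ⟦ suc k ⟧ {{positive (⟦suc⟧-pos k)}} (begin
  ⟦ suc k ⟧ * 0ℚ        ≡⟨ ℚ.*-zeroʳ ⟦ suc k ⟧ ⟩
  0ℚ                    ≤⟨ divW-nonNeg Ψ (∑-nonNeg (variables n) (λ i → ℚ.0≤∣p∣ (biasVar Ψ i))) ⟩
  divW Ψ (biasMass Ψ)   ≡⟨ ⟦k⟧*bias Ψ ⟨
  ⟦ suc k ⟧ * bias Ψ    ∎)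
  where open ℚ.≤-Reasoning

bias≤1 : ∀ (Ψ : Instance n (suc k)) → bias Ψ ℚ.≤ 1ℚ
bias≤1 {k = k} Ψ = ℚ.*-cancelˡ-≤-pos ⟦ suc k ⟧ {{positive (⟦suc⟧-pos k)}} (begin
  ⟦ suc k ⟧ * bias Ψ         ≡⟨ ⟦k⟧*bias Ψ ⟩
  divW Ψ (biasMass Ψ)        ≤⟨ divW-mono Ψ (biasMass≤kW Ψ) ⟩
  divW Ψ (⟦ suc k ⟧ * W Ψ)   ≡⟨ divW-*W Ψ ⟦ suc k ⟧ ⟩
  ⟦ suc k ⟧                  ≡⟨ ℚ.*-identityʳ ⟦ suc k ⟧ ⟨
  ⟦ suc k ⟧ * 1ℚ             ∎)
  where open ℚ.≤-Reasoning

threshold-assignmentValue-bias : ∀ t (Ψ : Instance n (suc k)) x →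
  ⟦ 2 ⟧ * ⟦ t ⟧ * assignmentValue (Th t (suc k)) Ψ x ℚ.≤ ⟦ suc k ⟧ * (1ℚ + bias Ψ)
threshold-assignmentValue-bias {k = k} t Ψ x = begin
  ⟦ 2 ⟧ * ⟦ t ⟧ * assignmentValue (Th t (suc k)) Ψ x  ≤⟨ threshold-assignmentValue Ψ t x ⟩
  ⟦ suc k ⟧ + divW Ψ (biasMass Ψ)                      ≡⟨ cong₂ _+_ (ℚ.*-identityʳ ⟦ suc k ⟧) (⟦k⟧*bias Ψ) ⟨
  ⟦ suc k ⟧ * 1ℚ + ⟦ suc k ⟧ * bias Ψ                  ≡⟨ ℚ.*-distribˡ-+ ⟦ suc k ⟧ 1ℚ (bias Ψ) ⟨
  ⟦ suc k ⟧ * (1ℚ + bias Ψ)                            ∎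
  where open ℚ.≤-Reasoning

foldr-⊔-attained : ∀ (f : A → ℚ) d (xs : List A) → ∃[ x ] foldr _⊔_ (f d) (map f xs) ≡ f x
foldr-⊔-attained f d []       = d , refl
foldr-⊔-attained f d (x ∷ xs) with ℚ.⊔-sel (f x) (foldr _⊔_ (f d) (map f xs)) | foldr-⊔-attained f d xs
... | inj₁ max≡fx   | _           = x , max≡fx
... | inj₂ max≡rest | y , rest≡fy = y , trans max≡rest rest≡fy

val-attained : ∀ (f : Bits k → ℚ) (Ψ : Instance n k) → ∃[ x ] val f Ψ ≡ assignmentValue f Ψ x
val-attained {n = n} f Ψ = foldr-⊔-attained (assignmentValue f Ψ) (replicate n false) (allBits n)

-- Counting strings by weight

#weight : ℕ → ℕ → ℚ
#weight k i = ∑[ a ∈ allBits k ] 𝟙 (weight a ℕ.≡ᵇ i)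

-- the number of strings 1a ∈ ℤ₂^(k+1) of weight i
#weight⁺ : ℕ → ℕ → ℚ
#weight⁺ k i = ∑[ a ∈ allBits k ] 𝟙 (suc (weight a) ℕ.≡ᵇ i)

#weight-nonNeg : ∀ k i → 0ℚ ℚ.≤ #weight k i
#weight-nonNeg k i = ∑-nonNeg (allBits k) (λ a → 𝟙-nonNeg (weight a ℕ.≡ᵇ i))

#weight-suc : ∀ k i → #weight (suc k) i ≡ #weight k i + #weight⁺ k i
#weight-suc k i = trans (∑-allBits-suc k (λ a → 𝟙 (weight a ℕ.≡ᵇ i)))
                        (∑-+ (allBits k) (λ a → 𝟙 (weight a ℕ.≡ᵇ i)) (λ a → 𝟙 (suc (weight a) ℕ.≡ᵇ i)))

#weight⁺-zero : ∀ k → #weight⁺ k 0 ≡ 0ℚ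
#weight⁺-zero k = ∑-zero (allBits k)

#weight-pos : ∀ {k i} → i ≤ k → 0ℚ ℚ.< #weight k i
#weight-pos {ℕ.zero} z≤n = ℚ.positive⁻¹ 1ℚ
#weight-pos {suc k} {ℕ.zero} z≤n = subst (0ℚ ℚ.<_) (sym (#weight-suc k 0))
  (ℚ.+-mono-<-≤ (#weight-pos {k} z≤n) (ℚ.≤-reflexive (sym (#weight⁺-zero k))))
#weight-pos {suc k} {suc j} (s≤s j≤k) = subst (0ℚ ℚ.<_) (sym (#weight-suc k (suc j)))
  (ℚ.+-mono-≤-< (#weight-nonNeg k (suc j)) (#weight-pos j≤k))

absorption : ∀ k i → ⟦ i ⟧ * #weight (suc k) i ≡ ⟦ suc k ⟧ * #weight⁺ k i
absorption k ℕ.zero = begin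
  0ℚ * #weight (suc k) 0    ≡⟨ ℚ.*-zeroˡ (#weight (suc k) 0) ⟩
  0ℚ                       ≡⟨ ℚ.*-zeroʳ ⟦ suc k ⟧ ⟨
  ⟦ suc k ⟧ * 0ℚ           ≡⟨ cong (⟦ suc k ⟧ *_) (#weight⁺-zero k) ⟨
  ⟦ suc k ⟧ * #weight⁺ k 0  ∎
  where open ≡-Reasoning
absorption ℕ.zero (suc ℕ.zero)  = refl
absorption ℕ.zero (suc (suc j)) = ℚ.*-zeroʳ ⟦ suc (suc j) ⟧
absorption (suc k) (suc j) = begin
  ⟦ suc j ⟧ * #weight (suc (suc k)) (suc j)
    ≡⟨ cong (⟦ suc j ⟧ *_) (#weight-suc (suc k) (suc j)) ⟩
  ⟦ suc j ⟧ * (#weight (suc k) (suc j) + #weight (suc k) j)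
    ≡⟨ split ⟦ j ⟧ (#weight (suc k) (suc j)) (#weight (suc k) j) ⟩
  ⟦ suc j ⟧ * #weight (suc k) (suc j) + ⟦ j ⟧ * #weight (suc k) j + #weight (suc k) j
    ≡⟨ cong₂ (λ u v → u + v + #weight (suc k) j) (absorption k (suc j)) (absorption k j) ⟩
  ⟦ suc k ⟧ * #weight k j + ⟦ suc k ⟧ * #weight⁺ k j + #weight (suc k) j
    ≡⟨ cong (_+ #weight (suc k) j) (ℚ.*-distribˡ-+ ⟦ suc k ⟧ (#weight k j) (#weight⁺ k j)) ⟨
  ⟦ suc k ⟧ * (#weight k j + #weight⁺ k j) + #weight (suc k) j
    ≡⟨ cong (λ u → ⟦ suc k ⟧ * u + #weight (suc k) j) (#weight-suc k j) ⟨
  ⟦ suc k ⟧ * #weight (suc k) j + #weight (suc k) j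
    ≡⟨ merge ⟦ suc k ⟧ (#weight (suc k) j) ⟩
  ⟦ suc (suc k) ⟧ * #weight (suc k) j
    ∎
  where
  open ≡-Reasoning
  split : ∀ J X Y → (1ℚ + J) * (X + Y) ≡ (1ℚ + J) * X + J * Y + Y
  split = solve-∀ ℚ-ring
  merge : ∀ K Y → K * Y + Y ≡ (1ℚ + K) * Y
  merge = solve-∀ ℚ-ring

-- Symmetric distributions

#weight-nonZero : ∀ {k i} → i ≤ k → NonZero (#weight k i)
#weight-nonZero {k} {i} i≤k = ℚ.pos⇒nonZero (#weight k i) {{positive (#weight-pos i≤k)}}

levelDensity : ∀ {k i} → i ≤ k → ℚ
levelDensity {k} {i} i≤k = (1/ #weight k i) {{#weight-nonZero i≤k}}

levelDensity*#weight : ∀ {k i} (i≤k : i ≤ k) → levelDensity i≤k * #weight k i ≡ 1ℚ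
levelDensity*#weight {k} {i} i≤k = ℚ.*-inverseˡ (#weight k i) {{#weight-nonZero i≤k}}

levelDensity-nonNeg : ∀ {k i} (i≤k : i ≤ k) → 0ℚ ℚ.≤ levelDensity i≤k
levelDensity-nonNeg {k} {i} i≤k = ℚ.nonNegative⁻¹ (levelDensity i≤k)
  {{ℚ.pos⇒nonNeg (levelDensity i≤k) {{ℚ.1/pos⇒pos (#weight k i) {{positive (#weight-pos i≤k)}}}}}}

uniform : ∀ {k i} → i ≤ k → Distribution k
uniform {k} {i} i≤k = record
  { prob   = λ a → levelDensity i≤k * 𝟙 (weight a ℕ.≡ᵇ i)
  ; nonneg = λ a → *-nonNeg (levelDensity-nonNeg i≤k) (𝟙-nonNeg (weight a ℕ.≡ᵇ i))
  ; total  = trans (∑-*ˡ (allBits k) (levelDensity i≤k) (λ a → 𝟙 (weight a ℕ.≡ᵇ i)))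
                   (levelDensity*#weight i≤k)
  }

uniform-symmetric : ∀ {k i} (i≤k : i ≤ k) → Symmetric (uniform i≤k)
uniform-symmetric {i = i} i≤k a a' w≡w' = cong (λ m → levelDensity i≤k * 𝟙 (m ℕ.≡ᵇ i)) w≡w'

massAt-uniform : ∀ {k i} (i≤k : i ≤ k) m → massAt (uniform i≤k) m ≡ 𝟙 (i ℕ.≡ᵇ m)
massAt-uniform {k} {i} i≤k m = begin
  ∑[ a ∈ allBits k ] (if weight a ℕ.≡ᵇ m then P a else 0ℚ)
    ≡⟨ ∑-cong (allBits k) (λ a → same-level (weight a)) ⟩
  ∑[ a ∈ allBits k ] (if i ℕ.≡ᵇ m then P a else 0ℚ)
    ≡⟨ ∑-if (allBits k) (i ℕ.≡ᵇ m) P ⟩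
  (if i ℕ.≡ᵇ m then ∑ (allBits k) P else 0ℚ)
    ≡⟨ cong (if i ℕ.≡ᵇ m then_else 0ℚ) (Distribution.total (uniform i≤k)) ⟩
  𝟙 (i ℕ.≡ᵇ m)
    ∎
  where
  open ≡-Reasoning
  P = Distribution.prob (uniform i≤k)
  c = levelDensity i≤k
  same-level : ∀ w → (if w ℕ.≡ᵇ m then c * 𝟙 (w ℕ.≡ᵇ i) else 0ℚ)
                     ≡ (if i ℕ.≡ᵇ m then c * 𝟙 (w ℕ.≡ᵇ i) else 0ℚ)
  same-level w with w ℕ.≡ᵇ i in w≡ᵇi
  ... | false = trans (if-zero (w ℕ.≡ᵇ m) (ℚ.*-zeroʳ c)) (sym (if-zero (i ℕ.≡ᵇ m) (ℚ.*-zeroʳ c)))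
  ... | true with refl ← ℕ.≡ᵇ⇒≡ w i (subst T (sym w≡ᵇi) _) = refl

γ-uniform : ∀ {k i} S (i≤k : i ≤ k) → γ S (uniform i≤k) ≡ 𝟙 (S i)
γ-uniform {k} {i} S i≤k = begin
  ∑[ m ∈ upTo (suc k) ] (if S m then massAt (uniform i≤k) m else 0ℚ)
    ≡⟨ ∑-cong (upTo (suc k)) (λ m → cong (if S m then_else 0ℚ) (massAt-uniform i≤k m)) ⟩
  ∑[ m ∈ upTo (suc k) ] (if S m then 𝟙 (i ℕ.≡ᵇ m) else 0ℚ)
    ≡⟨ ∑-cong (upTo (suc k)) (λ m → if-swap-then (S m) (i ℕ.≡ᵇ m)) ⟩
  ∑[ m ∈ upTo (suc k) ] (if i ℕ.≡ᵇ m then 𝟙 (S m) else 0ℚ)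
    ≡⟨ ∑-upTo-δ (s≤s i≤k) (λ m → 𝟙 (S m)) ⟩
  𝟙 (S i)
    ∎
  where open ≡-Reasoning

μ-uniform : ∀ {k i} (i≤k : i ≤ suc k) → ⟦ suc k ⟧ * μ (uniform i≤k) ≡ ⟦ 2 ⟧ * ⟦ i ⟧ - ⟦ suc k ⟧
μ-uniform {k} {i} i≤k = begin
  ⟦ suc k ⟧ * μ (uniform i≤k)
    ≡⟨ cong (⟦ suc k ⟧ *_) first-bit ⟩
  ⟦ suc k ⟧ * (c * #weight⁺ k i + - c * #weight k i)
    ≡⟨ regroup ⟦ suc k ⟧ c (#weight⁺ k i) (#weight k i) ⟩
  ⟦ 2 ⟧ * c * (⟦ suc k ⟧ * #weight⁺ k i) - ⟦ suc k ⟧ * (c * (#weight k i + #weight⁺ k i))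
    ≡⟨ cong₂ (λ u v → ⟦ 2 ⟧ * c * u - ⟦ suc k ⟧ * (c * v)) (absorption k i) (#weight-suc k i) ⟨
  ⟦ 2 ⟧ * c * (⟦ i ⟧ * #weight (suc k) i) - ⟦ suc k ⟧ * (c * #weight (suc k) i)
    ≡⟨ factor ⟦ i ⟧ ⟦ suc k ⟧ c (#weight (suc k) i) ⟩
  (⟦ 2 ⟧ * ⟦ i ⟧ - ⟦ suc k ⟧) * (c * #weight (suc k) i)
    ≡⟨ cong ((⟦ 2 ⟧ * ⟦ i ⟧ - ⟦ suc k ⟧) *_) (levelDensity*#weight i≤k) ⟩
  (⟦ 2 ⟧ * ⟦ i ⟧ - ⟦ suc k ⟧) * 1ℚ
    ≡⟨ ℚ.*-identityʳ _ ⟩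
  ⟦ 2 ⟧ * ⟦ i ⟧ - ⟦ suc k ⟧
    ∎
  where
  open ≡-Reasoning
  c = levelDensity i≤k
  signs : ∀ c x y → c * x * - 1ℚ + c * y * 1ℚ ≡ c * y + - c * x
  signs = solve-∀ ℚ-ring
  first-bit : μ (uniform i≤k) ≡ c * #weight⁺ k i + - c * #weight k i
  first-bit = begin
    ∑[ a ∈ allBits (suc k) ] c * 𝟙 (weight a ℕ.≡ᵇ i) * sign (not (Vec.head a))
      ≡⟨ ∑-allBits-suc k (λ a → c * 𝟙 (weight a ℕ.≡ᵇ i) * sign (not (Vec.head a))) ⟩
    ∑[ a ∈ allBits k ] (c * 𝟙 (weight a ℕ.≡ᵇ i) * - 1ℚ + c * 𝟙 (suc (weight a) ℕ.≡ᵇ i) * 1ℚ)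
      ≡⟨ ∑-cong (allBits k) (λ a → signs c (𝟙 (weight a ℕ.≡ᵇ i)) (𝟙 (suc (weight a) ℕ.≡ᵇ i))) ⟩
    ∑[ a ∈ allBits k ] (c * 𝟙 (suc (weight a) ℕ.≡ᵇ i) + - c * 𝟙 (weight a ℕ.≡ᵇ i))
      ≡⟨ ∑-linear (allBits k) c (- c) (λ a → 𝟙 (suc (weight a) ℕ.≡ᵇ i)) (λ a → 𝟙 (weight a ℕ.≡ᵇ i)) ⟩
    c * #weight⁺ k i + - c * #weight k i
      ∎
  regroup : ∀ K c P Q → K * (c * P + - c * Q) ≡ ⟦ 2 ⟧ * c * (K * P) - K * (c * (Q + P))
  regroup = solve-∀ ℚ-ring
  factor : ∀ I K c N → ⟦ 2 ⟧ * c * (I * N) - K * (c * N) ≡ (⟦ 2 ⟧ * I - K) * (c * N)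
  factor = solve-∀ ℚ-ring

mix : ∀ {k} p → 0ℚ ℚ.≤ p → p ℚ.≤ 1ℚ → Distribution k → Distribution k → Distribution k
mix {k} p 0≤p p≤1 D E = record
  { prob   = λ a → p * prob D a + (1ℚ - p) * prob E a
  ; nonneg = λ a → ℚ.+-mono-≤ (*-nonNeg 0≤p (nonneg D a)) (*-nonNeg (p≤q⇒0≤q-p p≤1) (nonneg E a))
  ; total  = begin
      ∑[ a ∈ allBits k ] (p * prob D a + (1ℚ - p) * prob E a)
        ≡⟨ ∑-linear (allBits k) p (1ℚ - p) (prob D) (prob E) ⟩
      p * ∑ (allBits k) (prob D) + (1ℚ - p) * ∑ (allBits k) (prob E)
        ≡⟨ cong₂ (λ u v → p * u + (1ℚ - p) * v) (total D) (total E) ⟩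
      p * 1ℚ + (1ℚ - p) * 1ℚ
        ≡⟨ convex-one p ⟩
      1ℚ
        ∎
  }
  where
  open Distribution
  open ≡-Reasoning
  convex-one : ∀ p → p * 1ℚ + (1ℚ - p) * 1ℚ ≡ 1ℚ
  convex-one = solve-∀ ℚ-ring

module _ {k} (p : ℚ) (0≤p : 0ℚ ℚ.≤ p) (p≤1 : p ℚ.≤ 1ℚ) (D E : Distribution k) where
  open Distribution

  mix-symmetric : Symmetric D → Symmetric E → Symmetric (mix p 0≤p p≤1 D E)
  mix-symmetric D-sym E-sym a a' w≡w' =
    cong₂ (λ u v → p * u + (1ℚ - p) * v) (D-sym a a' w≡w') (E-sym a a' w≡w')

  massAt-mix : ∀ m → massAt (mix p 0≤p p≤1 D E) m ≡ p * massAt D m + (1ℚ - p) * massAt E m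
  massAt-mix m =
    trans (∑-cong (allBits k) (λ a → if-linear (weight a ℕ.≡ᵇ m) p (1ℚ - p) (prob D a) (prob E a)))
          (∑-linear (allBits k) p (1ℚ - p) _ _)

  γ-mix : ∀ S → γ S (mix p 0≤p p≤1 D E) ≡ p * γ S D + (1ℚ - p) * γ S E
  γ-mix S =
    trans (∑-cong (upTo (suc k)) (λ m → trans (cong (if S m then_else 0ℚ) (massAt-mix m))
                                              (if-linear (S m) p (1ℚ - p) (massAt D m) (massAt E m))))
          (∑-linear (upTo (suc k)) p (1ℚ - p) _ _)

μ-mix : ∀ {k} p 0≤p p≤1 (D E : Distribution (suc k)) → μ (mix p 0≤p p≤1 D E) ≡ p * μ D + (1ℚ - p) * μ E
μ-mix {k} p 0≤p p≤1 D E =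
  trans (∑-cong (allBits (suc k)) (λ a → distrib p (1ℚ - p) (prob D a) (prob E a) (sign (not (Vec.head a)))))
        (∑-linear (allBits (suc k)) p (1ℚ - p) _ _)
  where
  open Distribution
  distrib : ∀ p q x y s → (p * x + q * y) * s ≡ p * (x * s) + q * (y * s)
  distrib = solve-∀ ℚ-ring

μ-mix-uniform : ∀ {k a b} (a≤ : a ≤ suc k) (b≤ : b ≤ suc k) p 0≤p p≤1 →
  ⟦ suc k ⟧ * μ (mix p 0≤p p≤1 (uniform b≤) (uniform a≤))
    ≡ p * (⟦ 2 ⟧ * ⟦ b ⟧) + (1ℚ - p) * (⟦ 2 ⟧ * ⟦ a ⟧) - ⟦ suc k ⟧
μ-mix-uniform {k} {a} {b} a≤ b≤ p 0≤p p≤1 = begin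
  ⟦ suc k ⟧ * μ (mix p 0≤p p≤1 (uniform b≤) (uniform a≤))
    ≡⟨ cong (⟦ suc k ⟧ *_) (μ-mix p 0≤p p≤1 (uniform b≤) (uniform a≤)) ⟩
  ⟦ suc k ⟧ * (p * μ (uniform b≤) + (1ℚ - p) * μ (uniform a≤))
    ≡⟨ distribute ⟦ suc k ⟧ p (μ (uniform b≤)) (μ (uniform a≤)) ⟩
  p * (⟦ suc k ⟧ * μ (uniform b≤)) + (1ℚ - p) * (⟦ suc k ⟧ * μ (uniform a≤))
    ≡⟨ cong₂ (λ u v → p * u + (1ℚ - p) * v) (μ-uniform b≤) (μ-uniform a≤) ⟩
  p * (⟦ 2 ⟧ * ⟦ b ⟧ - ⟦ suc k ⟧) + (1ℚ - p) * (⟦ 2 ⟧ * ⟦ a ⟧ - ⟦ suc k ⟧)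
    ≡⟨ collect p (⟦ 2 ⟧ * ⟦ b ⟧) (⟦ 2 ⟧ * ⟦ a ⟧) ⟦ suc k ⟧ ⟩
  p * (⟦ 2 ⟧ * ⟦ b ⟧) + (1ℚ - p) * (⟦ 2 ⟧ * ⟦ a ⟧) - ⟦ suc k ⟧
    ∎
  where
  open ≡-Reasoning
  distribute : ∀ K p x y → K * (p * x + (1ℚ - p) * y) ≡ p * (K * x) + (1ℚ - p) * (K * y)
  distribute = solve-∀ ℚ-ring
  collect : ∀ p B A K → p * (B - K) + (1ℚ - p) * (A - K) ≡ p * B + (1ℚ - p) * A - K
  collect = solve-∀ ℚ-ring

-- Matching the bias

record Interpolation (x y z : ℚ) : Set where
  field
    p            : ℚ
    0≤p          : 0ℚ ℚ.≤ p
    p≤1          : p ℚ.≤ 1ℚ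
    interpolates : p * z + (1ℚ - p) * x ≡ y

interpolate : ∀ {x y z} → x ℚ.< z → x ℚ.≤ y → y ℚ.≤ z → Interpolation x y z
interpolate {x} {y} {z} x<z x≤y y≤z = record { p = p ; 0≤p = 0≤p ; p≤1 = p≤1 ; interpolates = endpoints }
  where
  instance
    z-x-positive : Positive (z - x)
    z-x-positive = positive (subst (ℚ._< z - x) (ℚ.+-inverseʳ x) (ℚ.+-monoˡ-< (- x) x<z))
    z-x-nonZero : NonZero (z - x)
    z-x-nonZero = ℚ.pos⇒nonZero (z - x)
  p = (y - x) * 1/ (z - x)
  p*[z-x] : p * (z - x) ≡ y - x
  p*[z-x] = begin
    (y - x) * 1/ (z - x) * (z - x)    ≡⟨ ℚ.*-assoc (y - x) (1/ (z - x)) (z - x) ⟩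
    (y - x) * (1/ (z - x) * (z - x))  ≡⟨ cong ((y - x) *_) (ℚ.*-inverseˡ (z - x)) ⟩
    (y - x) * 1ℚ                      ≡⟨ ℚ.*-identityʳ (y - x) ⟩
    y - x                             ∎
    where open ≡-Reasoning
  0≤p : 0ℚ ℚ.≤ p
  0≤p = *-nonNeg (p≤q⇒0≤q-p x≤y)
                 (ℚ.nonNegative⁻¹ (1/ (z - x)) {{ℚ.pos⇒nonNeg (1/ (z - x)) {{ℚ.1/pos⇒pos (z - x)}}}})
  p≤1 : p ℚ.≤ 1ℚ
  p≤1 = ℚ.*-cancelʳ-≤-pos (z - x) (begin
    p * (z - x)    ≡⟨ p*[z-x] ⟩
    y - x          ≤⟨ ℚ.+-monoˡ-≤ (- x) y≤z ⟩
    z - x          ≡⟨ ℚ.*-identityˡ (z - x) ⟨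
    1ℚ * (z - x)   ∎)
    where open ℚ.≤-Reasoning
  endpoints : p * z + (1ℚ - p) * x ≡ y
  endpoints = begin
    p * z + (1ℚ - p) * x   ≡⟨ shift p x z ⟩
    x + p * (z - x)        ≡⟨ cong (x +_) p*[z-x] ⟩
    x + (y - x)            ≡⟨ cancel x y ⟩
    y                      ∎
    where
    open ≡-Reasoning
    shift : ∀ p x z → p * z + (1ℚ - p) * x ≡ x + p * (z - x)
    shift = solve-∀ ℚ-ring
    cancel : ∀ x y → x + (y - x) ≡ y
    cancel = solve-∀ ℚ-ring

-- The mixture of U_b and U_a whose mean weight is k(1 + β)/2, which is the weight for which μ = β.
module LevelMixture {k a b} (a≤ : a ≤ suc k) (b≤ : b ≤ suc k) {β}
                    (I : Interpolation (⟦ 2 ⟧ * ⟦ a ⟧) (⟦ suc k ⟧ * (1ℚ + β)) (⟦ 2 ⟧ * ⟦ b ⟧)) where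

  open Interpolation I public

  distribution : Distribution (suc k)
  distribution = mix p 0≤p p≤1 (uniform b≤) (uniform a≤)

  symmetric : Symmetric distribution
  symmetric = mix-symmetric p 0≤p p≤1 (uniform b≤) (uniform a≤) (uniform-symmetric b≤) (uniform-symmetric a≤)

  μ≡β : μ distribution ≡ β
  μ≡β = *-cancelˡ-≡-pos ⟦ suc k ⟧ {{positive (⟦suc⟧-pos k)}} (begin
    ⟦ suc k ⟧ * μ distribution
      ≡⟨ μ-mix-uniform a≤ b≤ p 0≤p p≤1 ⟩
    p * (⟦ 2 ⟧ * ⟦ b ⟧) + (1ℚ - p) * (⟦ 2 ⟧ * ⟦ a ⟧) - ⟦ suc k ⟧
      ≡⟨ cong (_- ⟦ suc k ⟧) interpolates ⟩
    ⟦ suc k ⟧ * (1ℚ + β) - ⟦ suc k ⟧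
      ≡⟨ cancel ⟦ suc k ⟧ β ⟩
    ⟦ suc k ⟧ * β
      ∎)
    where
    open ≡-Reasoning
    cancel : ∀ K β → K * (1ℚ + β) - K ≡ K * β
    cancel = solve-∀ ℚ-ring

  γ-distribution : ∀ S → γ S distribution ≡ p * 𝟙 (S b) + (1ℚ - p) * 𝟙 (S a)
  γ-distribution S = trans (γ-mix p 0≤p p≤1 (uniform b≤) (uniform a≤) S)
                           (cong₂ (λ u w → p * u + (1ℚ - p) * w) (γ-uniform S b≤) (γ-uniform S a≤))

≤γ-witness : ∀ {S k m q} (D : Distribution (suc k)) → Symmetric D → μ D ≡ m → q ℚ.≤ γ S D →
             q ≤γ[ S , suc k ] m
≤γ-witness D D-sym μ≡m q≤γ u u-bound = ℚ.≤-trans q≤γ (u-bound D D-sym μ≡m)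

≤γ-low : ∀ {k t} (t≤k : suc t ≤ suc k) {β v} →
  0ℚ ℚ.≤ ⟦ suc k ⟧ * (1ℚ + β) → ⟦ suc k ⟧ * (1ℚ + β) ℚ.≤ ⟦ 2 ⟧ * ⟦ suc t ⟧ →
  ⟦ 2 ⟧ * ⟦ suc t ⟧ * v ℚ.≤ ⟦ suc k ⟧ * (1ℚ + β) →
  v ≤γ[ interval (suc t) (suc k) , suc k ] β
≤γ-low {k} {t} t≤k {β} {v} 0≤κ κ≤2t 2tv≤κ =
  ≤γ-witness {S} distribution symmetric μ≡β (subst (v ℚ.≤_) (sym γ≡p) v≤p)
  where
  S = interval (suc t) (suc k)
  τ = ⟦ 2 ⟧ * ⟦ suc t ⟧
  0<τ : ⟦ 2 ⟧ * ⟦ 0 ⟧ ℚ.< τ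
  0<τ = ℚ.*-monoʳ-<-pos ⟦ 2 ⟧ (⟦suc⟧-pos t)
  open LevelMixture (z≤n {suc k}) t≤k {β} (interpolate 0<τ 0≤κ κ≤2t)
  v≤p : v ℚ.≤ p
  v≤p = ℚ.*-cancelˡ-≤-pos τ {{positive 0<τ}} (begin
    τ * v                   ≤⟨ 2tv≤κ ⟩
    ⟦ suc k ⟧ * (1ℚ + β)    ≡⟨ interpolates ⟨
    p * τ + (1ℚ - p) * 0ℚ   ≡⟨ drop-zero p τ ⟩
    τ * p                   ∎)
    where
    open ℚ.≤-Reasoning
    drop-zero : ∀ p T → p * T + (1ℚ - p) * 0ℚ ≡ T * p
    drop-zero = solve-∀ ℚ-ring
  γ≡p : γ S distribution ≡ p
  γ≡p = begin
    γ S distribution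
      ≡⟨ γ-distribution S ⟩
    p * 𝟙 (S (suc t)) + (1ℚ - p) * 0ℚ
      ≡⟨ cong (λ u → p * 𝟙 u + (1ℚ - p) * 0ℚ) (interval-member ℕ.≤-refl t≤k) ⟩
    p * 1ℚ + (1ℚ - p) * 0ℚ
      ≡⟨ drop-zero p ⟩
    p
      ∎
    where
    open ≡-Reasoning
    drop-zero : ∀ p → p * 1ℚ + (1ℚ - p) * 0ℚ ≡ p
    drop-zero = solve-∀ ℚ-ring

≤γ-high : ∀ {k t} (t≤k : suc t ≤ suc k) {β v} →
  ⟦ 2 ⟧ * ⟦ suc t ⟧ ℚ.< ⟦ suc k ⟧ * (1ℚ + β) → ⟦ suc k ⟧ * (1ℚ + β) ℚ.≤ ⟦ 2 ⟧ * ⟦ suc k ⟧ →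
  v ℚ.≤ 1ℚ → v ≤γ[ interval (suc t) (suc k) , suc k ] β
≤γ-high {k} {t} t≤k {β} {v} 2t<κ κ≤2k v≤1 =
  ≤γ-witness {S} distribution symmetric μ≡β (subst (v ℚ.≤_) (sym γ≡1) v≤1)
  where
  S = interval (suc t) (suc k)
  open LevelMixture t≤k (ℕ.≤-refl {suc k}) {β} (interpolate (ℚ.<-≤-trans 2t<κ κ≤2k) (ℚ.<⇒≤ 2t<κ) κ≤2k)
  γ≡1 : γ S distribution ≡ 1ℚ
  γ≡1 = begin
    γ S distribution
      ≡⟨ γ-distribution S ⟩
    p * 𝟙 (S (suc k)) + (1ℚ - p) * 𝟙 (S (suc t))
      ≡⟨ cong₂ (λ u w → p * 𝟙 u + (1ℚ - p) * 𝟙 w)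
               (interval-member t≤k ℕ.≤-refl) (interval-member ℕ.≤-refl t≤k) ⟩
    p * 1ℚ + (1ℚ - p) * 1ℚ
      ≡⟨ convex-one p ⟩
    1ℚ
      ∎
    where
    open ≡-Reasoning
    convex-one : ∀ p → p * 1ℚ + (1ℚ - p) * 1ℚ ≡ 1ℚ
    convex-one = solve-∀ ℚ-ring

threshold-≤γ : ∀ {k t} → 1 ≤ t → t ≤ suc k → ∀ {β v} → - 1ℚ ℚ.≤ β → β ℚ.≤ 1ℚ → v ℚ.≤ 1ℚ →
               ⟦ 2 ⟧ * ⟦ t ⟧ * v ℚ.≤ ⟦ suc k ⟧ * (1ℚ + β) → v ≤γ[ interval t (suc k) , suc k ] β
threshold-≤γ {k} {suc t} (s≤s z≤n) t≤k {β} -1≤β β≤1 v≤1 2tv≤κ =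
  [ (λ κ≤2t → ≤γ-low t≤k (*-nonNeg (⟦⟧-nonNeg (suc k)) 0≤1+β) κ≤2t 2tv≤κ)
  , (λ κ≰2t → ≤γ-high t≤k (ℚ.≰⇒> κ≰2t) κ≤2k v≤1)
  ]′ (toSum (⟦ suc k ⟧ * (1ℚ + β) ℚ.≤? ⟦ 2 ⟧ * ⟦ suc t ⟧))
  where
  0≤1+β : 0ℚ ℚ.≤ 1ℚ + β
  0≤1+β = ℚ.+-monoʳ-≤ 1ℚ -1≤β
  κ≤2k : ⟦ suc k ⟧ * (1ℚ + β) ℚ.≤ ⟦ 2 ⟧ * ⟦ suc k ⟧
  κ≤2k = ℚ.≤-trans (ℚ.*-monoˡ-≤-nonNeg ⟦ suc k ⟧ {{nonNegative (⟦⟧-nonNeg (suc k))}} (ℚ.+-monoʳ-≤ 1ℚ β≤1))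
                   (ℚ.≤-reflexive (ℚ.*-comm ⟦ suc k ⟧ ⟦ 2 ⟧))

lemma7p27 : (k t n : ℕ) → (k≥2 : 2 ≤ k) → 1 ≤ t → t ≤ k →
    (Ψ : Instance n k) →
    val (Th t k) Ψ ≤γ[ interval t k , k ] bias {{>-nonZero (≤-trans (s≤s z≤n) k≥2)}} Ψ
lemma7p27 (suc k) t n (s≤s _) 1≤t t≤k Ψ =
  subst (_≤γ[ interval t (suc k) , suc k ] bias Ψ) (sym val≡value)
    (threshold-≤γ 1≤t t≤k -1≤bias (bias≤1 Ψ) value≤1 (threshold-assignmentValue-bias t Ψ x))
  where
  open Σ (val-attained (Th t (suc k)) Ψ) renaming (proj₁ to x; proj₂ to val≡value)
  -1≤bias : - 1ℚ ℚ.≤ bias Ψ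
  -1≤bias = ℚ.≤-trans (ℚ.neg-antimono-≤ (ℚ.nonNegative⁻¹ 1ℚ)) (bias-nonNeg Ψ)
  value≤1 : assignmentValue (Th t (suc k)) Ψ x ℚ.≤ 1ℚ
  value≤1 = assignmentValue≤1 Ψ (λ a → 𝟙≤1 (interval t (suc k) (weight a))) x
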